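{- Let $(M_n)_{n\ge1}$, $M_n=(f_n(m,k))$, be the Delta sequence. For $p\ge0$ define the infinite matrix $\Omega^{(p)}=(\omega^{(p)}_{i,j})_{i,j\ge0}$ by $\omega^{(p)}_{i,j}=0$ if $i+j\not\equiv p\pmod2$, and $\omega^{(p)}_{i,j}=f_n(m,k)$ with $m=p+1$, $k=p+j+2$, $2n=p+i+j+2$ if $i+j\equiv p\pmod 2$. Then every $\Omega^{(p)}$ ($p\ge0$) is a Poupard matrix, i.e. $\omega^{(p)}_{i,j+2}-2\omega^{(p)}_{i+1,j+1}+\omega^{(p)}_{i+2,j}+2\omega^{(p)}_{i,j}=0$ for all $i,j\ge0$.
   Context: Delta sequence. For $n\ge1$, $M_n=(f_n(m,k))_{1\le m,k\le 2n}$ is a $2n\times 2n$ matrix; by convention $f_n(m,k)=0$ if $(m,k)\notin[1,2n]^2$. Write $f_n(m,\bullet)=\sum_{k=1}^{2n}f_n(m,k)$ and $f_n(\bullet,k)=\sum_{m=1}^{2n}f_n(m,k)$. Let $L_n^{(1)}=\{(m,k):2\le k+1\le m\le 2n-2\}$ and $U_n^{(1)}=\{(m,k):2\le m+1\le k\le 2n-2\}$. The Delta sequence is the unique sequence $(M_n)_{n\ge1}$ of matrices with nonnegative integer entries such that $M_1=\begin{pmatrix}0&0\\1&0\end{pmatrix}$ and, for every $n\ge2$: (a) $f_n(m,m)=0$ for all $m$; (b) $f_n(m+2,k)-2f_n(m+1,k)+f_n(m,k)+2f_{n-1}(m,k)=0$ for $(m,k)\in L_n^{(1)}$; (c) $f_n(m,k+2)-2f_n(m,k+1)+f_n(m,k)+2f_{n-1}(m,k)=0$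 for $(m,k)\in U_n^{(1)}$; (d) column $2n$ of $M_n$ is zero, and column $2n-1$ is $(f_{n-1}(1,\bullet),\dots,f_{n-1}(2n-2,\bullet),0,0)$ read top to bottom; (e) row $2n$ of $M_n$ is $(f_{n-1}(1,\bullet),\dots,f_{n-1}(2n-2,\bullet),0,0)$ read left to right, and row $2n-1$ is $(f_{n-1}(1,\bullet)+f_{n-1}(\bullet,1),\dots,f_{n-1}(2n-2,\bullet)+f_{n-1}(\bullet,2n-2),0,0)$. (These conditions determine the sequence uniquely.) -}

module Defs where

open import Data.Nat using (ℕ; zero; suc; _+_; _*_; _≤_; _<_; ⌊_/2⌋; _%_)
open import Data.Nat.Properties using (_≟_)
open import Data.Sum using (_⊎_)
open import Data.Product using (_×_)
open import Relation.Nullary using (yes; no)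
open import Relation.Binary.PropositionalEquality using (_≡_)

-- A sequence of matrices is encoded as  f : ℕ → ℕ → ℕ → ℕ ,  f n m k = f_n(m,k),
-- 1-based indices m, k; only n ≥ 1 is meaningful.

Σ1 : ℕ → (ℕ → ℕ) → ℕ
Σ1 zero    g = 0
Σ1 (suc N) g = Σ1 N g + g (suc N)

rowSum : (ℕ → ℕ → ℕ → ℕ) → ℕ → ℕ → ℕ
rowSum f n m = Σ1 (2 * n) (λ k → f n m k)

colSum : (ℕ → ℕ → ℕ → ℕ) → ℕ → ℕ → ℕ
colSum f n k = Σ1 (2 * n) (λ m → f n m k)

record IsDeltaSequence (f : ℕ → ℕ → ℕ → ℕ) : Set where
  field
    outside : ∀ n m k → 1 ≤ n → (m ≡ 0 ⊎ k ≡ 0 ⊎ 2 * n < m ⊎ 2 * n < k) → f n m k ≡ 0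
    init₁₁ : f 1 1 1 ≡ 0
    init₁₂ : f 1 1 2 ≡ 0
    init₂₁ : f 1 2 1 ≡ 1
    init₂₂ : f 1 2 2 ≡ 0
    -- conditions for N = suc n ≥ 2 (so n ≥ 1, 2N = 2n+2, 2N-1 = 2n+1, 2N-2 = 2n)
    -- (a)
    diag : ∀ n → 1 ≤ n → ∀ m → f (suc n) m m ≡ 0
    -- (b) for 1 ≤ k, k+1 ≤ m ≤ 2n ; equation rearranged in ℕ
    lower : ∀ n → 1 ≤ n → ∀ m k → 1 ≤ k → k + 1 ≤ m → m ≤ 2 * n →
      f (suc n) (m + 2) k + f (suc n) m k + 2 * f n m k ≡ 2 * f (suc n) (m + 1) k
    upper : ∀ n → 1 ≤ n → ∀ m k → 1 ≤ m → m + 1 ≤ k → k ≤ 2 * n →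
      f (suc n) m (k + 2) + f (suc n) m k + 2 * f n m k ≡ 2 * f (suc n) m (k + 1)
    col2N   : ∀ n → 1 ≤ n → ∀ m → f (suc n) m (2 * n + 2) ≡ 0
    col2N-1 : ∀ n → 1 ≤ n → ∀ m → 1 ≤ m → m ≤ 2 * n → f (suc n) m (2 * n + 1) ≡ rowSum f n m
    col2N-1a : ∀ n → 1 ≤ n → f (suc n) (2 * n + 1) (2 * n + 1) ≡ 0
    col2N-1b : ∀ n → 1 ≤ n → f (suc n) (2 * n + 2) (2 * n + 1) ≡ 0
    row2N   : ∀ n → 1 ≤ n → ∀ k → 1 ≤ k → k ≤ 2 * n → f (suc n) (2 * n + 2) k ≡ rowSum f n k
    row2Na  : ∀ n → 1 ≤ n → f (suc n) (2 * n + 2) (2 * n + 1) ≡ 0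
    row2Nb  : ∀ n → 1 ≤ n → f (suc n) (2 * n + 2) (2 * n + 2) ≡ 0
    row2N-1 : ∀ n → 1 ≤ n → ∀ k → 1 ≤ k → k ≤ 2 * n →
      f (suc n) (2 * n + 1) k ≡ rowSum f n k + colSum f n k
    row2N-1a : ∀ n → 1 ≤ n → f (suc n) (2 * n + 1) (2 * n + 1) ≡ 0
    row2N-1b : ∀ n → 1 ≤ n → f (suc n) (2 * n + 1) (2 * n + 2) ≡ 0

omega : (ℕ → ℕ → ℕ → ℕ) → ℕ → ℕ → ℕ → ℕ
omega f p i j with (p + i + j) % 2 ≟ 0
... | yes _ = f ⌊ p + i + j + 2 /2⌋ (p + 1) (p + j + 2)
... | no  _ = 0

-- Poupard matrix: ω_{i,j+2} − 2ω_{i+1,j+1} + ω_{i+2,j} + 2ω_{i,j} = 0 (rearranged in ℕ)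
IsPoupard : (ℕ → ℕ → ℕ) → Set
IsPoupard w = ∀ i j → w i (j + 2) + w (i + 2) j + 2 * w i j ≡ 2 * w (i + 1) (j + 1)

module Submission where

-- The entry ω^{(p)}_{i,j} only depends on the antidiagonal index
-- s = p + i + j: it vanishes when s is odd, and when s = 2q it is the entry
-- f_{q+1}(p+1, p+j+2) of M_{q+1}.  The four entries ω_{i,j+2}, ω_{i+2,j},
-- ω_{i+1,j+1}, ω_{i,j} of a Poupard relation lie on antidiagonals s+2, s+2,
-- s+2, s, so they all have the parity of s.
--   * s odd:  all four entries vanish and the relation is 0 = 0.
--   * s = 2q: with m = p+1 and k = p+j+2 the four entries are
--     f_{q+2}(m,k+2), f_{q+2}(m,k), f_{q+1}(m,k) and f_{q+2}(m,k+1), so the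
--     Poupard relation is literally the "upper" recursion (c) of the Delta
--     sequence for n = q+2; its range conditions m+1 ≤ k ≤ 2(q+1) follow
--     from j ≥ 0 and i ≥ 0.
-- The file first establishes parity and halving facts, then evaluates ω on
-- even and odd antidiagonals, proves the relation in each parity case, and
-- finally combines the two cases.

open import Defs
open import Data.Nat using (ℕ; zero; suc; _+_; _*_; _≤_; z≤n; s≤s; ⌊_/2⌋; _%_)
open import Data.Nat.Properties
  using (_≟_; +-comm; +-assoc; +-identityʳ; *-comm; *-suc; m≤m+n; m≤n+m;
         +-monoˡ-≤; +-monoʳ-≤; n≡⌊n+n/2⌋; module ≤-Reasoning)
open import Data.Nat.DivMod using ([m+kn]%n≡m%n; m*n%n≡0)
open import Data.Nat.Solver using (module +-*-Solver)
open import Data.Empty using (⊥-elim)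
open import Data.Sum using (_⊎_; inj₁; inj₂)
open import Data.Product using (∃-syntax; _,_)
open import Relation.Nullary using (yes; no)
open import Relation.Binary.PropositionalEquality
  using (_≡_; refl; sym; trans; cong; cong₂; module ≡-Reasoning)

open +-*-Solver using (solve; _:+_; _:=_; con)

parity : ∀ s → ∃[ q ] (s ≡ 2 * q ⊎ s ≡ 1 + 2 * q)
parity zero = 0 , inj₁ refl
parity (suc s) with parity s
... | q , inj₁ even = q , inj₂ (cong suc even)
... | q , inj₂ odd  = suc q , inj₁ (trans (cong suc odd) (sym (*-suc 2 q)))

even-rem : ∀ q → (2 * q) % 2 ≡ 0
even-rem q = trans (cong (_% 2) (*-comm 2 q)) (m*n%n≡0 q 2)

odd-rem : ∀ q → (1 + 2 * q) % 2 ≡ 1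
odd-rem q = trans (cong (λ x → (1 + x) % 2) (*-comm 2 q)) ([m+kn]%n≡m%n 1 q 2)

half-even+2 : ∀ q → ⌊ 2 * q + 2 /2⌋ ≡ suc q
half-even+2 q = begin
  ⌊ 2 * q + 2 /2⌋    ≡⟨ cong ⌊_/2⌋ (+-comm (2 * q) 2) ⟩
  suc ⌊ 2 * q /2⌋    ≡⟨ cong (λ x → suc ⌊ q + x /2⌋) (+-identityʳ q) ⟩
  suc ⌊ q + q /2⌋    ≡⟨ cong suc (sym (n≡⌊n+n/2⌋ q)) ⟩
  suc q              ∎
  where open ≡-Reasoning

-- On an even antidiagonal p + i + j = 2q, ω^{(p)}_{i,j} is the entry of M_{q+1}
-- in row p+1 and column p+j+2 (the column is given up to a provable equality).
omega-even : ∀ f p i j q {k} → p + i + j ≡ 2 * q → p + j + 2 ≡ k →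
             omega f p i j ≡ f (suc q) (p + 1) k
omega-even f p i j q e refl with (p + i + j) % 2 ≟ 0
... | yes _ = cong (λ n → f n (p + 1) (p + j + 2))
                   (trans (cong (λ s → ⌊ s + 2 /2⌋) e) (half-even+2 q))
... | no odd = ⊥-elim (odd (trans (cong (_% 2) e) (even-rem q)))

omega-odd : ∀ f p i j q → p + i + j ≡ 1 + 2 * q → omega f p i j ≡ 0
omega-odd f p i j q e with (p + i + j) % 2 ≟ 0
... | no _ = refl
... | yes rem0 with trans (sym (trans (cong (_% 2) e) (odd-rem q))) rem0
... | ()

antidiagonal-j+2 : ∀ p i j → p + i + (j + 2) ≡ 2 + (p + i + j)
antidiagonal-j+2 = solve 3 (λ p i j → p :+ i :+ (j :+ con 2) := con 2 :+ (p :+ i :+ j)) refl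

antidiagonal-i+2 : ∀ p i j → p + (i + 2) + j ≡ 2 + (p + i + j)
antidiagonal-i+2 = solve 3 (λ p i j → p :+ (i :+ con 2) :+ j := con 2 :+ (p :+ i :+ j)) refl

antidiagonal-i+1,j+1 : ∀ p i j → p + (i + 1) + (j + 1) ≡ 2 + (p + i + j)
antidiagonal-i+1,j+1 =
  solve 3 (λ p i j → p :+ (i :+ con 1) :+ (j :+ con 1) := con 2 :+ (p :+ i :+ j)) refl

next-even : ∀ {s t} q → t ≡ 2 + s → s ≡ 2 * q → t ≡ 2 * suc q
next-even q t≡2+s refl = trans t≡2+s (sym (*-suc 2 q))

next-odd : ∀ {s t} q → t ≡ 2 + s → s ≡ 1 + 2 * q → t ≡ 1 + 2 * suc q
next-odd q t≡2+s refl = trans t≡2+s (cong suc (sym (*-suc 2 q)))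

PoupardAt : (ℕ → ℕ → ℕ) → ℕ → ℕ → Set
PoupardAt w i j = w i (j + 2) + w (i + 2) j + 2 * w i j ≡ 2 * w (i + 1) (j + 1)

poupard-odd : ∀ f p i j q → p + i + j ≡ 1 + 2 * q → PoupardAt (omega f p) i j
poupard-odd f p i j q odd
  rewrite omega-odd f p i (j + 2) (suc q) (next-odd q (antidiagonal-j+2 p i j) odd)
        | omega-odd f p (i + 2) j (suc q) (next-odd q (antidiagonal-i+2 p i j) odd)
        | omega-odd f p i j q odd
        | omega-odd f p (i + 1) (j + 1) (suc q) (next-odd q (antidiagonal-i+1,j+1 p i j) odd)
  = refl

-- Range conditions of recursion (c) at row p+1 and column p+j+2 of M_{q+2}:
-- the column lies strictly right of the diagonal (j ≥ 0) ...
row<column : ∀ p j → p + 1 + 1 ≤ p + j + 2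
row<column p j = begin
  p + 1 + 1    ≡⟨ +-assoc p 1 1 ⟩
  p + 2        ≤⟨ +-monoʳ-≤ p (m≤n+m 2 j) ⟩
  p + (j + 2)  ≡⟨ sym (+-assoc p j 2) ⟩
  p + j + 2    ∎
  where open ≤-Reasoning

-- ... and within the first 2(q+1) columns when p + i + j = 2q (i ≥ 0).
column≤size : ∀ p i j q → p + i + j ≡ 2 * q → p + j + 2 ≤ 2 * suc q
column≤size p i j q even = begin
  p + j + 2      ≤⟨ +-monoˡ-≤ 2 (+-monoˡ-≤ j (m≤m+n p i)) ⟩
  p + i + j + 2  ≡⟨ cong (_+ 2) even ⟩
  2 * q + 2      ≡⟨ +-comm (2 * q) 2 ⟩
  2 + 2 * q      ≡⟨ sym (*-suc 2 q) ⟩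
  2 * suc q      ∎
  where open ≤-Reasoning

-- Even antidiagonal p + i + j = 2q: the relation is recursion (c) of the Delta
-- sequence for M_{q+2}, at row m = p+1 and column k = p+j+2.
poupard-even : ∀ f → IsDeltaSequence f → ∀ p i j q → p + i + j ≡ 2 * q →
               PoupardAt (omega f p) i j
poupard-even f D p i j q even = begin
  ω i (j + 2) + ω (i + 2) j + 2 * ω i j
    ≡⟨ cong₂ _+_ (cong₂ _+_ ω[i,j+2] ω[i+2,j]) (cong (2 *_) ω[i,j]) ⟩
  f (2 + q) m (k + 2) + f (2 + q) m k + 2 * f (1 + q) m k
    ≡⟨ IsDeltaSequence.upper D (suc q) (s≤s z≤n) m k (m≤n+m 1 p) (row<column p j) (column≤size p i j q even) ⟩
  2 * f (2 + q) m (k + 1)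
    ≡⟨ cong (2 *_) (sym ω[i+1,j+1]) ⟩
  2 * ω (i + 1) (j + 1)
    ∎
  where
  open ≡-Reasoning
  ω = omega f p
  m = p + 1
  k = p + j + 2

  ω[i,j+2] : ω i (j + 2) ≡ f (2 + q) m (k + 2)
  ω[i,j+2] = omega-even f p i (j + 2) (suc q) (next-even q (antidiagonal-j+2 p i j) even)
    (solve 2 (λ p j → p :+ (j :+ con 2) :+ con 2 := p :+ j :+ con 2 :+ con 2) refl p j)

  ω[i+2,j] : ω (i + 2) j ≡ f (2 + q) m k
  ω[i+2,j] = omega-even f p (i + 2) j (suc q) (next-even q (antidiagonal-i+2 p i j) even) refl

  ω[i,j] : ω i j ≡ f (1 + q) m k
  ω[i,j] = omega-even f p i j q even refl

  ω[i+1,j+1] : ω (i + 1) (j + 1) ≡ f (2 + q) m (k + 1)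
  ω[i+1,j+1] = omega-even f p (i + 1) (j + 1) (suc q) (next-even q (antidiagonal-i+1,j+1 p i j) even)
    (solve 2 (λ p j → p :+ (j :+ con 1) :+ con 2 := p :+ j :+ con 2 :+ con 1) refl p j)

proposition9p6 : (f : ℕ → ℕ → ℕ → ℕ) → IsDeltaSequence f → ∀ p → IsPoupard (omega f p)
proposition9p6 f D p i j with parity (p + i + j)
... | q , inj₁ even = poupard-even f D p i j q even
... | q , inj₂ odd  = poupard-odd f p i j q odd
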